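{- For every $x\in\mathcal{S}_n$, $|\mathcal{E}(\{x\})|=3^{z(x)}\big(2^{\,n-z(x)}-1\big)$, where $z(x)$ is the number of zero coordinates of $x$.
   Context: $\mathcal{S}_n$ is the set of nonzero tuples in $\{ -1,0,1\}^n$ whose first nonzero entry is $1$. A tuple $t\in\{1,0,-1,u\}^n$ eliminates $s\in\mathcal{S}_n$ if: (i) $t_i\neq0$ and $s_i\ne0$ for some $i$; (ii) there is $k\in\{+1,-1\}$ with $t_i=ks_i$ for all $i$ with $s_i\ne0$ and $t_i\ne0$; (iii) $s_i=0$ whenever $t_i=u$. For a set $X$ of tuples, $\mathcal{E}(X)$ is the set of elements of $\mathcal{S}_n$ eliminated by some element of $X$. -}

module Defs where

open import Data.Nat using (ℕ; zero; suc)
open import Data.Fin using (Fin; _<_)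
open import Data.Fin.Properties using (any?; all?; _<?_)
open import Data.Vec using (Vec; []; _∷_; lookup; count)
open import Data.List using (List; []; _∷_; concatMap; map; filter; length)
open import Data.Product using (_×_; _,_; ∃; ∃-syntax)
open import Data.Sum using (_⊎_; inj₁; inj₂)
open import Relation.Nullary using (¬_; Dec; yes; no)
open import Relation.Nullary.Decidable using (_×-dec_; _⊎-dec_; ¬?; _→-dec_)
open import Relation.Binary.PropositionalEquality using (_≡_; refl)

-- Symbols: one = 1, zer = 0, mone = -1, u = the extra symbol u.
data Sym : Set where
  one zer mone u : Sym

_≟S_ : (a b : Sym) → Dec (a ≡ b)
one  ≟S one  = yes refl
one  ≟S zer  = no λ ()
one  ≟S mone = no λ ()
one  ≟S u    = no λ ()
zer  ≟S one  = no λ ()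
zer  ≟S zer  = yes refl
zer  ≟S mone = no λ ()
zer  ≟S u    = no λ ()
mone ≟S one  = no λ ()
mone ≟S zer  = no λ ()
mone ≟S mone = yes refl
mone ≟S u    = no λ ()
u    ≟S one  = no λ ()
u    ≟S zer  = no λ ()
u    ≟S mone = no λ ()
u    ≟S u    = yes refl

data Sgn : Set where
  plus minus : Sgn

_·_ : Sgn → Sym → Sym
plus  · a    = a
minus · one  = mone
minus · zer  = zer
minus · mone = one
minus · u    = u

InS : ∀ {n} → Vec Sym n → Set
InS {n} s =
  (∀ i → ¬ (lookup s i ≡ u)) ×
  (∃[ i ] ¬ (lookup s i ≡ zer)) ×
  (∃[ i ] (lookup s i ≡ one × (∀ j → j < i → lookup s j ≡ zer)))

Eliminates : ∀ {n} → Vec Sym n → Vec Sym n → Set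
Eliminates {n} t s =
  (∃[ i ] (¬ (lookup t i ≡ zer) × ¬ (lookup s i ≡ zer))) ×
  (∃[ k ] (∀ i → ¬ (lookup s i ≡ zer) → ¬ (lookup t i ≡ zer) → lookup t i ≡ k · lookup s i)) ×
  (∀ i → lookup t i ≡ u → lookup s i ≡ zer)

InS? : ∀ {n} (s : Vec Sym n) → Dec (InS s)
InS? s =
  all? (λ i → ¬? (lookup s i ≟S u)) ×-dec
  (any? (λ i → ¬? (lookup s i ≟S zer)) ×-dec
   any? (λ i → (lookup s i ≟S one) ×-dec all? (λ j → (j <? i) →-dec (lookup s j ≟S zer))))

Eliminates? : ∀ {n} (t s : Vec Sym n) → Dec (Eliminates t s)
Eliminates? t s =
  any? (λ i → ¬? (lookup t i ≟S zer) ×-dec ¬? (lookup s i ≟S zer)) ×-dec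
  (sgn? ×-dec all? (λ i → lookup t i ≟S u →-dec (lookup s i ≟S zer)))
  where
  P : Sgn → Set
  P k = ∀ i → ¬ (lookup s i ≡ zer) → ¬ (lookup t i ≡ zer) → lookup t i ≡ k · lookup s i
  P? : ∀ k → Dec (P k)
  P? k = all? (λ i → ¬? (lookup s i ≟S zer) →-dec (¬? (lookup t i ≟S zer) →-dec (lookup t i ≟S (k · lookup s i))))
  sgn? : Dec (∃[ k ] P k)
  sgn? with P? plus | P? minus
  ... | yes p | _     = yes (plus , p)
  ... | no _  | yes q = yes (minus , q)
  ... | no ¬p | no ¬q = no λ { (plus , p) → ¬p p ; (minus , q) → ¬q q }

allTuples : ∀ n → List (Vec Sym n)
allTuples zero    = [] ∷ []
allTuples (suc n) = concatMap (λ a → map (a ∷_) (allTuples n)) (one ∷ zer ∷ mone ∷ u ∷ [])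

Sₙ : ∀ n → List (Vec Sym n)
Sₙ n = filter InS? (allTuples n)

cardE₁ : ∀ {n} → Vec Sym n → ℕ
cardE₁ {n} t = length (filter (Eliminates? t) (Sₙ n))

z : ∀ {n} → Vec Sym n → ℕ
z x = count (_≟S zer) x

-- Fix x ∈ {1,0,-1}ⁿ with z zeros. For a fixed sign k, the s agreeing with k·x on the common support
-- form a product set: any entry where x is 0, and 0 or k·xᵢ elsewhere, so there are 3^z·2^(n∸z) of
-- them. Splitting the tuples s by their first entry gives recurrences in x for the number M of
-- eliminated s (of either sign) and the number N of normalized ones: at the first coordinate where s
-- and x are both nonzero the sign is forced, and a normalized s starts with 0 or 1. Induction gives
-- M + 2·3^z = 2·3^z·2^(n∸z) and N + 3^z = 3^z·2^(n∸z).
module Submission where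

open import Defs
open import Data.Nat using (ℕ; _*_; _∸_; _^_; _+_; suc; s≤s; z≤n)
open import Data.Nat.Properties
  using ( m+n∸n≡m; +-∸-assoc; *-distribˡ-∸; *-distribˡ-+; *-identityʳ; +-identityʳ
        ; +-assoc; +-comm; *-assoc; +-commutativeSemigroup; *-commutativeSemigroup )
open import Data.Nat.Tactic.RingSolver using (solve-∀)
import Algebra.Properties.CommutativeSemigroup +-commutativeSemigroup as +-Semigroup
open import Algebra.Properties.CommutativeSemigroup *-commutativeSemigroup using (x∙yz≈y∙xz)
open import Data.Bool using (true; false; if_then_else_)
open import Data.Empty using (⊥-elim)
open import Data.Fin using (_<_; zero; suc)
open import Data.Fin.Properties using (any?; all?; _<?_; ∀-cons-⇔; ⊎⇔∃)
open import Data.List using (List; []; _∷_; _++_; map; filter; length; concatMap)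
open import Data.Nat.ListAction using (sum)
open import Data.List.Properties using (filter-≐; filter-++; length-++; filter-none; map-cong)
open import Data.List.Relation.Unary.All using (universal)
open import Data.Product using (_×_; _,_; ∃; ∃-syntax; proj₁; proj₂)
open import Data.Sum using (_⊎_; inj₁; inj₂; [_,_])
open import Data.Vec using (Vec; []; _∷_; lookup)
open import Data.Vec.Properties using (count≤n)
open import Function using (_∘_; _⇔_; mk⇔; Equivalence)
import Function.Properties.Equivalence as ⇔
open import Data.Product.Function.NonDependent.Propositional using (_×-⇔_)
open import Relation.Binary.PropositionalEquality
  using (_≡_; _≢_; refl; sym; trans; cong; cong₂; subst; module ≡-Reasoning)
open import Relation.Nullary using (¬_; Dec; yes; no; does)
open import Relation.Nullary.Decidable using (¬?; _×-dec_; _⊎-dec_; _→-dec_; map′; toSum)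
open import Relation.Unary using (Decidable)
open import Relation.Unary.Properties using (_∩?_)

private variable
  n : ℕ
  a b : Sym
  k : Sgn
  x s : Vec Sym n

length-filter-map : {A B : Set} {P : B → Set} (P? : Decidable P) (f : A → B) (xs : List A) →
                    length (filter P? (map f xs)) ≡ length (filter (P? ∘ f) xs)
length-filter-map P? f [] = refl
length-filter-map P? f (x ∷ xs) with P? (f x)
... | yes _ = cong suc (length-filter-map P? f xs)
... | no _  = length-filter-map P? f xs

filter-filter : {A : Set} {P Q : A → Set} (P? : Decidable P) (Q? : Decidable Q) (xs : List A) →
                filter Q? (filter P? xs) ≡ filter (P? ∩? Q?) xs
filter-filter P? Q? [] = refl
filter-filter P? Q? (x ∷ xs) with P? x
... | no _ = filter-filter P? Q? xs
... | yes _ with Q? x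
...   | yes _ = cong (x ∷_) (filter-filter P? Q? xs)
...   | no _  = filter-filter P? Q? xs

sum-map-if : {A : Sym → Set} (A? : Decidable A) (m : ℕ) (bs : List Sym) →
             sum (map (λ b → if does (A? b) then m else 0) bs) ≡ length (filter A? bs) * m
sum-map-if A? m [] = refl
sum-map-if A? m (b ∷ bs) with does (A? b)
... | true  = cong (m +_) (sum-map-if A? m bs)
... | false = sum-map-if A? m bs

symbols : List Sym
symbols = one ∷ zer ∷ mone ∷ u ∷ []

-- Opaque, so that unification keeps # P? rigid instead of unfolding it into a list computation.
opaque
  #_ : {P : Vec Sym n → Set} → Decidable P → ℕ
  #_ {n} P? = length (filter P? (allTuples n))

opaque
  unfolding #_

  #-cong : {P Q : Vec Sym n → Set} (P? : Decidable P) (Q? : Decidable Q) →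
           (∀ v → P v ⇔ Q v) → # P? ≡ # Q?
  #-cong {n} {P} {Q} P? Q? P⇔Q = cong length (filter-≐ P? Q? (P⊆Q , Q⊆P) (allTuples n))
    where
    P⊆Q : ∀ {v} → P v → Q v
    P⊆Q {v} = Equivalence.to (P⇔Q v)
    Q⊆P : ∀ {v} → Q v → P v
    Q⊆P {v} = Equivalence.from (P⇔Q v)

  #-empty : {P : Vec Sym n → Set} (P? : Decidable P) → (∀ v → ¬ P v) → # P? ≡ 0
  #-empty {n} P? ¬P = cong length (filter-none P? (universal ¬P (allTuples n)))

  #-[] : {P : Vec Sym 0 → Set} (P? : Decidable P) → # P? ≡ (if does (P? []) then 1 else 0)
  #-[] P? with does (P? [])
  ... | true  = refl
  ... | false = refl

  #-∷ : {P : Vec Sym (suc n) → Set} (P? : Decidable P) →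
        # P? ≡ sum (map (λ b → # (λ s → P? (b ∷ s))) symbols)
  #-∷ {n} P? = go symbols
    where
    go : (bs : List Sym) →
         length (filter P? (concatMap (λ b → map (b ∷_) (allTuples n)) bs))
           ≡ sum (map (λ b → # (λ s → P? (b ∷ s))) bs)
    go []       = refl
    go (b ∷ bs) = begin
      length (filter P? (map (b ∷_) (allTuples n) ++ rest))
        ≡⟨ cong length (filter-++ P? (map (b ∷_) (allTuples n)) rest) ⟩
      length (filter P? (map (b ∷_) (allTuples n)) ++ filter P? rest)
        ≡⟨ length-++ (filter P? (map (b ∷_) (allTuples n))) ⟩
      length (filter P? (map (b ∷_) (allTuples n))) + length (filter P? rest)
        ≡⟨ cong₂ _+_ (length-filter-map P? (b ∷_) (allTuples n)) (go bs) ⟩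
      # (λ s → P? (b ∷ s)) + sum (map (λ b → # (λ s → P? (b ∷ s))) bs) ∎
      where
      open ≡-Reasoning
      rest : List (Vec Sym (suc n))
      rest = concatMap (λ b → map (b ∷_) (allTuples n)) bs

#-by-slices : {P : Vec Sym (suc n) → Set} (P? : Decidable P) {c₁ c₂ c₃ c₄ : ℕ} →
              # (λ s → P? (one ∷ s)) ≡ c₁ → # (λ s → P? (zer ∷ s)) ≡ c₂ →
              # (λ s → P? (mone ∷ s)) ≡ c₃ → # (λ s → P? (u ∷ s)) ≡ c₄ →
              # P? ≡ c₁ + (c₂ + (c₃ + (c₄ + 0)))
#-by-slices P? e₁ e₂ e₃ e₄ =
  trans (#-∷ P?) (cong₂ _+_ e₁ (cong₂ _+_ e₂ (cong₂ _+_ e₃ (cong₂ _+_ e₄ refl))))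

#-guard : {A : Set} {P Q : Vec Sym n → Set} (P? : Decidable P) (A? : Dec A) (Q? : Decidable Q) →
          (∀ v → P v ⇔ (A × Q v)) → # P? ≡ (if does A? then # Q? else 0)
#-guard P? (yes a) Q? P⇔A×Q =
  #-cong P? Q? λ v → mk⇔ (proj₂ ∘ Equivalence.to (P⇔A×Q v)) (Equivalence.from (P⇔A×Q v) ∘ (a ,_))
#-guard P? (no ¬a) Q? P⇔A×Q = #-empty P? λ v → ¬a ∘ proj₁ ∘ Equivalence.to (P⇔A×Q v)

Ternary : Vec Sym n → Set
Ternary x = ∀ i → lookup x i ≢ u

-- Condition (ii) at one coordinate; it also keeps u out of s, so Agree k x s entails s ∈ {1,0,-1}ⁿ.
Compatible : Sgn → Sym → Sym → Set
Compatible k a b = b ≢ u × (b ≢ zer → a ≢ zer → a ≡ k · b)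

Agree : Sgn → Vec Sym n → Vec Sym n → Set
Agree k x s = ∀ i → Compatible k (lookup x i) (lookup s i)

Meet : Vec Sym n → Vec Sym n → Set
Meet x s = ∃[ i ] (lookup x i ≢ zer × lookup s i ≢ zer)

-- Condition (iii) is left out: it is vacuous when x has no u (see inS×eliminates⇔inE).
Eliminated : Vec Sym n → Vec Sym n → Set
Eliminated x s = Meet x s × ∃[ k ] Agree k x s

Normalized : Vec Sym n → Set
Normalized s = ∃[ i ] (lookup s i ≡ one × ∀ j → j < i → lookup s j ≡ zer)

InE : Vec Sym n → Vec Sym n → Set
InE x s = Normalized s × Eliminated x s

compatible? : ∀ k a b → Dec (Compatible k a b)
compatible? k a b = ¬? (b ≟S u) ×-dec (¬? (b ≟S zer) →-dec (¬? (a ≟S zer) →-dec (a ≟S (k · b))))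

agree? : ∀ k (x : Vec Sym n) → Decidable (Agree k x)
agree? k x s = all? λ i → compatible? k (lookup x i) (lookup s i)

meet? : (x : Vec Sym n) → Decidable (Meet x)
meet? x s = any? λ i → ¬? (lookup x i ≟S zer) ×-dec ¬? (lookup s i ≟S zer)

∃-Sgn? : {P : Sgn → Set} → (∀ k → Dec (P k)) → Dec (∃ P)
∃-Sgn? P? = map′ (λ { (inj₁ p) → plus , p ; (inj₂ q) → minus , q })
                 (λ { (plus , p) → inj₁ p ; (minus , q) → inj₂ q })
                 (P? plus ⊎-dec P? minus)

eliminated? : (x : Vec Sym n) → Decidable (Eliminated x)
eliminated? x s = meet? x s ×-dec ∃-Sgn? λ k → agree? k x s

normalized? : Decidable (Normalized {n})
normalized? s = any? λ i → (lookup s i ≟S one) ×-dec all? (λ j → (j <? i) →-dec (lookup s j ≟S zer))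

inE? : (x : Vec Sym n) → Decidable (InE x)
inE? x s = normalized? s ×-dec eliminated? x s

agree-∷ : Agree k (a ∷ x) (b ∷ s) ⇔ (Compatible k a b × Agree k x s)
agree-∷ = ⇔.sym ∀-cons-⇔

meet-∷ : Meet (a ∷ x) (b ∷ s) ⇔ ((a ≢ zer × b ≢ zer) ⊎ Meet x s)
meet-∷ = ⇔.sym ⊎⇔∃

normalized-zer∷ : Normalized (zer ∷ s) ⇔ Normalized s
normalized-zer∷ = mk⇔ to from
  where
  to : Normalized (zer ∷ s) → Normalized s
  to (suc i , s≡one , before) = i , s≡one , λ j j<i → before (suc j) (s≤s j<i)
  from : Normalized s → Normalized (zer ∷ s)
  from (i , s≡one , before) = suc i , s≡one , λ { zero _ → refl ; (suc j) (s≤s j<i) → before j j<i }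

normalized-one∷ : Normalized (one ∷ s)
normalized-one∷ = zero , refl , λ _ ()

¬normalized-∷ : b ≢ one → b ≢ zer → ¬ Normalized (b ∷ s)
¬normalized-∷ b≢one _     (zero , b≡one , _)  = b≢one b≡one
¬normalized-∷ _     b≢zer (suc _ , _ , before) = b≢zer (before zero (s≤s z≤n))

·-cancelʳ : ∀ {k k′} → b ≢ zer → b ≢ u → k · b ≡ k′ · b → k ≡ k′
·-cancelʳ {one}  {plus}  {plus}  _ _ _ = refl
·-cancelʳ {one}  {minus} {minus} _ _ _ = refl
·-cancelʳ {mone} {plus}  {plus}  _ _ _ = refl
·-cancelʳ {mone} {minus} {minus} _ _ _ = refl
·-cancelʳ {zer}  b≢zer _ _ = ⊥-elim (b≢zer refl)
·-cancelʳ {u}    _ b≢u _   = ⊥-elim (b≢u refl)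
·-cancelʳ {one}  {plus}  {minus} _ _ ()
·-cancelʳ {one}  {minus} {plus}  _ _ ()
·-cancelʳ {mone} {plus}  {minus} _ _ ()
·-cancelʳ {mone} {minus} {plus}  _ _ ()

eliminated-∷-skip : (a ≡ zer ⊎ b ≡ zer) → b ≢ u → Eliminated (a ∷ x) (b ∷ s) ⇔ Eliminated x s
eliminated-∷-skip {a} {b} a∨b≡zer b≢u = mk⇔ to from
  where
  apart : ¬ (a ≢ zer × b ≢ zer)
  apart (a≢zer , b≢zer) = [ a≢zer , b≢zer ] a∨b≡zer
  to : Eliminated (a ∷ x) (b ∷ s) → Eliminated x s
  to (meet , k , agree) with Equivalence.to meet-∷ meet
  ... | inj₁ both = ⊥-elim (apart both)
  ... | inj₂ meet′ = meet′ , k , proj₂ (Equivalence.to agree-∷ agree)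
  from : Eliminated x s → Eliminated (a ∷ x) (b ∷ s)
  from (meet , k , agree) =
    Equivalence.from meet-∷ (inj₂ meet) ,
    k , Equivalence.from agree-∷ ((b≢u , λ b≢zer a≢zer → ⊥-elim (apart (a≢zer , b≢zer))) , agree)

eliminated-∷-hit : a ≡ k · b → a ≢ zer → b ≢ zer → b ≢ u → Eliminated (a ∷ x) (b ∷ s) ⇔ Agree k x s
eliminated-∷-hit {a} {k} {b} {x = x} {s = s} a≡kb a≢zer b≢zer b≢u = mk⇔ to from
  where
  to : Eliminated (a ∷ x) (b ∷ s) → Agree k x s
  to (_ , k′ , agree) with Equivalence.to agree-∷ agree
  ... | (_ , a≡k′b) , agree′ =
    subst (λ k → Agree k x s) (·-cancelʳ b≢zer b≢u (trans (sym (a≡k′b b≢zer a≢zer)) a≡kb)) agree′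
  from : Agree k x s → Eliminated (a ∷ x) (b ∷ s)
  from agree = (zero , a≢zer , b≢zer) , k , Equivalence.from agree-∷ ((b≢u , λ _ _ → a≡kb) , agree)

¬eliminated-∷u : ¬ Eliminated (a ∷ x) (u ∷ s)
¬eliminated-∷u (_ , _ , agree) = proj₁ (agree zero) refl

inE-∷zer : InE (a ∷ x) (zer ∷ s) ⇔ InE x s
inE-∷zer = normalized-zer∷ ×-⇔ eliminated-∷-skip (inj₂ refl) λ ()

inE-∷one : InE (a ∷ x) (one ∷ s) ⇔ Eliminated (a ∷ x) (one ∷ s)
inE-∷one = mk⇔ proj₂ (normalized-one∷ ,_)

weight : Vec Sym n → ℕ
weight {n} x = 3 ^ z x * 2 ^ (n ∸ z x)

z-nonzero∷ : a ≢ zer → z (a ∷ x) ≡ z x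
z-nonzero∷ {one}  _     = refl
z-nonzero∷ {mone} _     = refl
z-nonzero∷ {u}    _     = refl
z-nonzero∷ {zer}  a≢zer = ⊥-elim (a≢zer refl)

weight-zer∷ : (x : Vec Sym n) → weight (zer ∷ x) ≡ 3 * weight x
weight-zer∷ {n} x = *-assoc 3 (3 ^ z x) (2 ^ (n ∸ z x))

weight-nonzero∷ : a ≢ zer → (x : Vec Sym n) → weight (a ∷ x) ≡ 2 * weight x
weight-nonzero∷ {n = n} a≢zer x
  rewrite z-nonzero∷ {x = x} a≢zer | +-∸-assoc 1 (count≤n (_≟S zer) x) =
  x∙yz≈y∙xz (3 ^ z x) 2 (2 ^ (n ∸ z x))

choices : Sgn → Sym → ℕ
choices k a = length (filter (compatible? k a) symbols)

choices-nonzero : ∀ k → a ≢ zer → a ≢ u → choices k a ≡ 2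
choices-nonzero {one}  plus  _ _ = refl
choices-nonzero {one}  minus _ _ = refl
choices-nonzero {mone} plus  _ _ = refl
choices-nonzero {mone} minus _ _ = refl
choices-nonzero {zer}  _ a≢zer _ = ⊥-elim (a≢zer refl)
choices-nonzero {u}    _ _ a≢u   = ⊥-elim (a≢u refl)

#agree-∷ : ∀ k a (x : Vec Sym n) → # (agree? k (a ∷ x)) ≡ choices k a * # (agree? k x)
#agree-∷ k a x = begin
  # (agree? k (a ∷ x))
    ≡⟨ #-∷ (agree? k (a ∷ x)) ⟩
  sum (map (λ b → # (λ s → agree? k (a ∷ x) (b ∷ s))) symbols)
    ≡⟨ cong sum (map-cong slice symbols) ⟩
  sum (map (λ b → if does (compatible? k a b) then # (agree? k x) else 0) symbols)
    ≡⟨ sum-map-if (compatible? k a) (# (agree? k x)) symbols ⟩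
  choices k a * # (agree? k x) ∎
  where
  open ≡-Reasoning
  slice : ∀ b → # (λ s → agree? k (a ∷ x) (b ∷ s)) ≡ (if does (compatible? k a b) then # (agree? k x) else 0)
  slice b = #-guard _ (compatible? k a b) (agree? k x) λ _ → agree-∷

#agree : ∀ k (x : Vec Sym n) → Ternary x → # (agree? k x) ≡ weight x
#agree k []      _ = #-[] (agree? k [])
#agree k (a ∷ x) t with toSum (a ≟S zer)
... | inj₁ refl = begin
  # (agree? k (zer ∷ x))  ≡⟨ #agree-∷ k zer x ⟩
  3 * # (agree? k x)      ≡⟨ cong (3 *_) (#agree k x (t ∘ suc)) ⟩
  3 * weight x            ≡⟨ sym (weight-zer∷ x) ⟩
  weight (zer ∷ x)        ∎
  where open ≡-Reasoning
... | inj₂ a≢zer = begin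
  # (agree? k (a ∷ x))
    ≡⟨ #agree-∷ k a x ⟩
  choices k a * # (agree? k x)
    ≡⟨ cong₂ _*_ (choices-nonzero k a≢zer (t zero)) (#agree k x (t ∘ suc)) ⟩
  2 * weight x
    ≡⟨ sym (weight-nonzero∷ a≢zer x) ⟩
  weight (a ∷ x) ∎
  where open ≡-Reasoning

#eliminated-∷-skip : (a ≡ zer ⊎ b ≡ zer) → b ≢ u →
                     # (λ s → eliminated? (a ∷ x) (b ∷ s)) ≡ # (eliminated? x)
#eliminated-∷-skip {a} {b} {x = x} a∨b≡zer b≢u =
  #-cong (λ s → eliminated? (a ∷ x) (b ∷ s)) (eliminated? x) λ _ → eliminated-∷-skip a∨b≡zer b≢u

#eliminated-∷-hit : a ≡ k · b → a ≢ zer → b ≢ zer → b ≢ u → Ternary x →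
                    # (λ s → eliminated? (a ∷ x) (b ∷ s)) ≡ weight x
#eliminated-∷-hit {a} {k} {b} {x = x} a≡kb a≢zer b≢zer b≢u t =
  trans (#-cong (λ s → eliminated? (a ∷ x) (b ∷ s)) (agree? k x)
                λ _ → eliminated-∷-hit a≡kb a≢zer b≢zer b≢u)
        (#agree k x t)

#eliminated-∷u : # (λ s → eliminated? (a ∷ x) (u ∷ s)) ≡ 0
#eliminated-∷u {a} {x = x} = #-empty (λ s → eliminated? (a ∷ x) (u ∷ s)) λ _ → ¬eliminated-∷u

#eliminated-zer∷ : (x : Vec Sym n) → # (eliminated? (zer ∷ x)) ≡ 3 * # (eliminated? x)
#eliminated-zer∷ x =
  #-by-slices (eliminated? (zer ∷ x)) (skip λ ()) (skip λ ()) (skip λ ()) #eliminated-∷u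
  where
  skip : b ≢ u → # (λ s → eliminated? (zer ∷ x) (b ∷ s)) ≡ # (eliminated? x)
  skip = #eliminated-∷-skip (inj₁ refl)

#eliminated-∷one : a ≢ zer → a ≢ u → Ternary x → # (λ s → eliminated? (a ∷ x) (one ∷ s)) ≡ weight x
#eliminated-∷one {one}  _ _ = #eliminated-∷-hit {one} {plus} refl (λ ()) (λ ()) (λ ())
#eliminated-∷one {mone} _ _ = #eliminated-∷-hit {mone} {minus} refl (λ ()) (λ ()) (λ ())
#eliminated-∷one {zer}  a≢zer _ = ⊥-elim (a≢zer refl)
#eliminated-∷one {u}    _ a≢u   = ⊥-elim (a≢u refl)

#eliminated-∷mone : a ≢ zer → a ≢ u → Ternary x → # (λ s → eliminated? (a ∷ x) (mone ∷ s)) ≡ weight x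
#eliminated-∷mone {one}  _ _ = #eliminated-∷-hit {one} {minus} refl (λ ()) (λ ()) (λ ())
#eliminated-∷mone {mone} _ _ = #eliminated-∷-hit {mone} {plus} refl (λ ()) (λ ()) (λ ())
#eliminated-∷mone {zer}  a≢zer _ = ⊥-elim (a≢zer refl)
#eliminated-∷mone {u}    _ a≢u   = ⊥-elim (a≢u refl)

#eliminated-nonzero∷ : a ≢ zer → a ≢ u → Ternary x →
                       # (eliminated? (a ∷ x)) ≡ # (eliminated? x) + 2 * weight x
#eliminated-nonzero∷ {a} {x = x} a≢zer a≢u t =
  trans (#-by-slices (eliminated? (a ∷ x))
                     (#eliminated-∷one a≢zer a≢u t)
                     (#eliminated-∷-skip (inj₂ refl) (λ ()))
                     (#eliminated-∷mone a≢zer a≢u t)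
                     #eliminated-∷u)
        (+-Semigroup.x∙yz≈y∙xz (weight x) (# (eliminated? x)) (weight x + 0))

#inE-∷one : # (λ s → inE? (a ∷ x) (one ∷ s)) ≡ # (λ s → eliminated? (a ∷ x) (one ∷ s))
#inE-∷one {a} {x = x} =
  #-cong (λ s → inE? (a ∷ x) (one ∷ s)) (λ s → eliminated? (a ∷ x) (one ∷ s)) λ _ → inE-∷one

#inE-∷zer : # (λ s → inE? (a ∷ x) (zer ∷ s)) ≡ # (inE? x)
#inE-∷zer {a} {x = x} = #-cong (λ s → inE? (a ∷ x) (zer ∷ s)) (inE? x) λ _ → inE-∷zer

#inE-∷-unnormalized : b ≢ one → b ≢ zer → # (λ s → inE? (a ∷ x) (b ∷ s)) ≡ 0
#inE-∷-unnormalized {b} {a} {x = x} b≢one b≢zer =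
  #-empty (λ s → inE? (a ∷ x) (b ∷ s)) λ _ → ¬normalized-∷ b≢one b≢zer ∘ proj₁

#inE-zer∷ : (x : Vec Sym n) → # (inE? (zer ∷ x)) ≡ # (eliminated? x) + # (inE? x)
#inE-zer∷ x =
  trans (#-by-slices (inE? (zer ∷ x))
                     (trans #inE-∷one (#eliminated-∷-skip (inj₁ refl) (λ ())))
                     #inE-∷zer
                     (#inE-∷-unnormalized (λ ()) (λ ()))
                     (#inE-∷-unnormalized (λ ()) (λ ())))
        (cong (# (eliminated? x) +_) (+-identityʳ (# (inE? x))))

#inE-nonzero∷ : a ≢ zer → a ≢ u → Ternary x → # (inE? (a ∷ x)) ≡ weight x + # (inE? x)
#inE-nonzero∷ {a} {x = x} a≢zer a≢u t =
  trans (#-by-slices (inE? (a ∷ x))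
                     (trans #inE-∷one (#eliminated-∷one a≢zer a≢u t))
                     #inE-∷zer
                     (#inE-∷-unnormalized (λ ()) (λ ()))
                     (#inE-∷-unnormalized (λ ()) (λ ())))
        (cong (weight x +_) (+-identityʳ (# (inE? x))))

-- The counts of M and N are stated with 3^z moved to the left, avoiding truncated subtraction.
#eliminated : (x : Vec Sym n) → Ternary x → # (eliminated? x) + 2 * 3 ^ z x ≡ 2 * weight x
#eliminated []      _ = cong (_+ 2) (#-[] (eliminated? []))
#eliminated (a ∷ x) t with toSum (a ≟S zer)
... | inj₁ refl = begin
  # (eliminated? (zer ∷ x)) + 2 * (3 * P)  ≡⟨ cong₂ _+_ (#eliminated-zer∷ x) (x∙yz≈y∙xz 2 3 P) ⟩
  3 * M + 3 * (2 * P)                      ≡⟨ sym (*-distribˡ-+ 3 M (2 * P)) ⟩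
  3 * (M + 2 * P)                          ≡⟨ cong (3 *_) (#eliminated x (t ∘ suc)) ⟩
  3 * (2 * W)                              ≡⟨ x∙yz≈y∙xz 3 2 W ⟩
  2 * (3 * W)                              ≡⟨ cong (2 *_) (sym (weight-zer∷ x)) ⟩
  2 * weight (zer ∷ x)                     ∎
  where
  open ≡-Reasoning
  P = 3 ^ z x
  M = # (eliminated? x)
  W = weight x
... | inj₂ a≢zer = begin
  # (eliminated? (a ∷ x)) + 2 * 3 ^ z (a ∷ x)
    ≡⟨ cong₂ _+_ (#eliminated-nonzero∷ a≢zer (t zero) (t ∘ suc))
                 (cong (λ m → 2 * 3 ^ m) (z-nonzero∷ {x = x} a≢zer)) ⟩
  (M + 2 * W) + 2 * P  ≡⟨ +-Semigroup.xy∙z≈xz∙y M (2 * W) (2 * P) ⟩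
  (M + 2 * P) + 2 * W  ≡⟨ cong (_+ 2 * W) (#eliminated x (t ∘ suc)) ⟩
  2 * W + 2 * W        ≡⟨ twice-double W ⟩
  2 * (2 * W)          ≡⟨ cong (2 *_) (sym (weight-nonzero∷ a≢zer x)) ⟩
  2 * weight (a ∷ x)   ∎
  where
  open ≡-Reasoning
  twice-double : ∀ w → 2 * w + 2 * w ≡ 2 * (2 * w)
  twice-double = solve-∀
  P = 3 ^ z x
  M = # (eliminated? x)
  W = weight x

#inE : (x : Vec Sym n) → Ternary x → # (inE? x) + 3 ^ z x ≡ weight x
#inE []      _ = cong (_+ 1) (#-[] (inE? []))
#inE (a ∷ x) t with toSum (a ≟S zer)
... | inj₁ refl = begin
  # (inE? (zer ∷ x)) + 3 * P   ≡⟨ cong (_+ 3 * P) (#inE-zer∷ x) ⟩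
  (M + N) + 3 * P              ≡⟨ regroup M N P ⟩
  (M + 2 * P) + (N + P)        ≡⟨ cong₂ _+_ (#eliminated x (t ∘ suc)) (#inE x (t ∘ suc)) ⟩
  2 * W + W                    ≡⟨ +-comm (2 * W) W ⟩
  3 * W                        ≡⟨ sym (weight-zer∷ x) ⟩
  weight (zer ∷ x)             ∎
  where
  open ≡-Reasoning
  P = 3 ^ z x
  M = # (eliminated? x)
  N = # (inE? x)
  W = weight x
  regroup : ∀ m n p → (m + n) + 3 * p ≡ (m + 2 * p) + (n + p)
  regroup = solve-∀
... | inj₂ a≢zer = begin
  # (inE? (a ∷ x)) + 3 ^ z (a ∷ x)
    ≡⟨ cong₂ _+_ (#inE-nonzero∷ a≢zer (t zero) (t ∘ suc)) (cong (3 ^_) (z-nonzero∷ {x = x} a≢zer)) ⟩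
  (W + N) + P        ≡⟨ +-assoc W N P ⟩
  W + (N + P)        ≡⟨ cong (W +_) (#inE x (t ∘ suc)) ⟩
  W + W              ≡⟨ cong (W +_) (sym (+-identityʳ W)) ⟩
  2 * W              ≡⟨ sym (weight-nonzero∷ a≢zer x) ⟩
  weight (a ∷ x)     ∎
  where
  open ≡-Reasoning
  P = 3 ^ z x
  N = # (inE? x)
  W = weight x

opaque
  unfolding #_

  cardE₁≡# : (x : Vec Sym n) → cardE₁ x ≡ # (InS? ∩? Eliminates? x)
  cardE₁≡# {n} x = cong length (filter-filter InS? (Eliminates? x) (allTuples n))

normalized⇒nonzero : Normalized s → ∃[ i ] lookup s i ≢ zer
normalized⇒nonzero (i , s≡one , _) = i , subst (_≢ zer) (sym s≡one) λ ()

inS×eliminates⇔inE : Ternary x → ∀ s → (InS s × Eliminates x s) ⇔ InE x s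
inS×eliminates⇔inE {x = x} ternary s = mk⇔ to from
  where
  to : InS s × Eliminates x s → InE x s
  to ((s-ternary , _ , normalized) , meet , (k , agree) , _) =
    normalized , meet , k , λ i → s-ternary i , agree i
  from : InE x s → InS s × Eliminates x s
  from (normalized , meet , k , agree) =
    (proj₁ ∘ agree , normalized⇒nonzero {s = s} normalized , normalized) ,
    meet , (k , proj₂ ∘ agree) , λ i xᵢ≡u → ⊥-elim (ternary i xᵢ≡u)

mainTheorem9 : (n : ℕ) (x : Vec Sym n) → InS x →
    cardE₁ x ≡ 3 ^ z x * (2 ^ (n ∸ z x) ∸ 1)
mainTheorem9 n x (ternary , _) = begin
  cardE₁ x                   ≡⟨ cardE₁≡# x ⟩
  # (InS? ∩? Eliminates? x)  ≡⟨ #-cong _ (inE? x) (inS×eliminates⇔inE {x = x} ternary) ⟩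
  # (inE? x)                 ≡⟨ sym (m+n∸n≡m (# (inE? x)) P) ⟩
  # (inE? x) + P ∸ P         ≡⟨ cong (_∸ P) (#inE x ternary) ⟩
  P * Q ∸ P                  ≡⟨ cong (P * Q ∸_) (sym (*-identityʳ P)) ⟩
  P * Q ∸ P * 1              ≡⟨ sym (*-distribˡ-∸ P Q 1) ⟩
  P * (Q ∸ 1)                ∎
  where
  open ≡-Reasoning
  P = 3 ^ z x
  Q = 2 ^ (n ∸ z x)
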